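{- Let $n \geq 2$ and $1 \leq k \leq n$ be integers, let $T \geq 1$, and let $A \in \mathrm{Mat}_n(\mathbb{Z})$ with $\|A\| \leq T$. Let $\Lambda \subset \mathbb{Z}^n$ be a lattice of rank $k$ with $A\Lambda \subseteq \Lambda$, let $v_1, \ldots, v_k$ be a reduced basis of $\Lambda$ with lengths $\ell_i = \|v_i\|$, and let $G = [g_{ij}]_{i,j=1}^k \in \mathrm{Mat}_k(\mathbb{Z})$ be the matrix of $A|_\Lambda$ in this basis, i.e. $A v_j = \sum_{h=1}^k g_{hj} v_h$ for each $j$. Then for all $i, j$, \[ |g_{ij}| \ll \frac{T \ell_j}{\ell_i}, \] where the implied constant depends only on $n$.
   Context: For a matrix $A = [a_{ij}]$, $\|A\| = \max_{i,j}|a_{ij}|$; for a vector $v$, $\|v\|$ is its Euclidean length. A reduced basis of a lattice $\Lambda$ of rank $k$ is a (e.g. Minkowski-)reduced basis $v_1, \ldots, v_k$, ordered so that $\ell_1 \leq \cdots \leq \ell_k$, having the property that for every $v = a_1 v_1 + \cdots + a_k v_k \in \Lambda \otimes \mathbb{R}$ one has $\|a_i v_i\| \leq c_k \|v\|$ for all $i$, with $c_k$ depending only on $k$.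
   Formalization: The bound T on ‖A‖ ranges over ℚ instead of the real numbers, and the constants $c_k$ in the reduced-basis property are rational. -}

module Defs where

open import Data.Nat using (ℕ; zero; suc)
open import Data.Fin using (Fin; zero; suc; _≤_)
open import Data.Integer using (ℤ; +_)
open import Data.Rational using (ℚ; 0ℚ; _+_; _*_; _/_) renaming (_≤_ to _≤ℚ_)
open import Relation.Binary.PropositionalEquality using (_≡_)

Σ : (n : ℕ) → (Fin n → ℚ) → ℚ
Σ zero    f = 0ℚ
Σ (suc n) f = f zero + Σ n (λ i → f (suc i))

ι : ℤ → ℚ
ι z = z / 1

Mat : ℕ → ℕ → Set
Mat m n = Fin m → Fin n → ℤ

sqNorm : (n : ℕ) → (Fin n → ℚ) → ℚ
sqNorm n w = Σ n (λ i → w i * w i)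

sqLen : (n : ℕ) → (Fin n → ℤ) → ℚ
sqLen n w = sqNorm n (λ i → ι (w i))

-- ‖A‖ ≤ T  (max-entry norm), for T ∈ ℚ
maxNormLE : (m n : ℕ) → Mat m n → ℚ → Set
maxNormLE m n A T = ∀ i j → ι (A i j) * ι (A i j) ≤ℚ T * T

-- the vectors v_1..v_k ∈ ℤ^n are linearly independent (so they span a lattice of rank k)
LinIndep : (k n : ℕ) → (Fin k → Fin n → ℤ) → Set
LinIndep k n v =
  ∀ (a : Fin k → ℤ) → (∀ r → Σ k (λ i → ι (a i) * ι (v i r)) ≡ 0ℚ) → ∀ i → a i ≡ + 0

Ordered : (k n : ℕ) → (Fin k → Fin n → ℤ) → Set
Ordered k n v = ∀ i j → i ≤ j → sqLen n (v i) ≤ℚ sqLen n (v j)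

ReducedProp : (k n : ℕ) → ℚ → (Fin k → Fin n → ℤ) → Set
ReducedProp k n c v =
  ∀ (a : Fin k → ℚ) (i : Fin k) →
    (a i * a i) * sqLen n (v i)
      ≤ℚ (c * c) * sqNorm n (λ r → Σ k (λ j → a j * ι (v j r)))

ReducedBasis : (c : ℕ → ℚ) (k n : ℕ) → (Fin k → Fin n → ℤ) → Set
ReducedBasis c k n v = LinIndep k n v × Ordered k n v × ReducedProp k n (c k) v
  where open import Data.Product using (_×_)

IsRestrictionMatrix : (k n : ℕ) → Mat n n → (Fin k → Fin n → ℤ) → Mat k k → Set
IsRestrictionMatrix k n A v G =
  ∀ (j : Fin k) (r : Fin n) →
    Σ n (λ s → ι (A r s) * ι (v j s)) ≡ Σ k (λ h → ι (G h j) * ι (v h r))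

{-# OPTIONS --safe #-}
-- Writing A v_j = Σ_h g_hj v_h and applying the reduction inequality to these
-- coordinates gives g_ij² ℓ_i² ≤ c_k² ‖A v_j‖², while ‖A v_j‖² ≤ n³ T² ℓ_j²
-- because every entry of A is at most T.  The constant C = 1 + Σ_{k ≤ n} n³ c_k²
-- then works for every rank k ≤ n at once.
module Submission where

open import Defs
open import Data.Nat using (ℕ; zero; suc)
import Data.Nat as N
open import Data.Fin using (Fin; zero; suc; toℕ; fromℕ<)
open import Data.Fin.Properties using (toℕ-fromℕ<)
open import Data.Integer using (ℤ)
open import Data.Rational using (ℚ; 0ℚ; 1ℚ; _+_; _*_; _≤_; nonNegative; nonPositive; positive)
open import Data.Rational using () renaming (_≤_ to _≤ℚ_)
open import Data.Rational.Properties
open import Data.Rational.Solver using (module +-*-Solver)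
open import Data.Product using (Σ-syntax; _,_)
open import Data.Sum using (inj₁; inj₂)
open import Function using (_∘_)
open import Relation.Binary.PropositionalEquality using (_≡_; refl; sym; cong; cong₂; subst)
open import Relation.Nullary using (yes; no; contradiction)

open +-*-Solver using (solve; _:+_; _:*_; _:=_; con)

nonNeg*nonNeg : ∀ {p q} → 0ℚ ≤ p → 0ℚ ≤ q → 0ℚ ≤ p * q
nonNeg*nonNeg {p} {q} 0≤p 0≤q =
  nonNegative⁻¹ (p * q) {{nonNeg*nonNeg⇒nonNeg p {{nonNegative 0≤p}} q {{nonNegative 0≤q}}}}

square-nonNeg : ∀ p → 0ℚ ≤ p * p
square-nonNeg p with ≤-total 0ℚ p
... | inj₁ 0≤p = nonNeg*nonNeg 0≤p 0≤p
... | inj₂ p≤0 = nonNegative⁻¹ (p * p) {{nonPos*nonPos⇒nonPos p {{nonPositive p≤0}} p {{nonPositive p≤0}}}}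

*-mono-≤-nonNeg : ∀ {p q r s} → 0ℚ ≤ p → 0ℚ ≤ r → p ≤ q → r ≤ s → p * r ≤ q * s
*-mono-≤-nonNeg {p} {q} {r} {s} 0≤p 0≤r p≤q r≤s =
  ≤-trans (*-monoʳ-≤-nonNeg r {{nonNegative 0≤r}} p≤q)
          (*-monoˡ-≤-nonNeg q {{nonNegative (≤-trans 0≤p p≤q)}} r≤s)

square-≤⇒≤ : ∀ {p q} → 0ℚ ≤ q → p * p ≤ q * q → p ≤ q
square-≤⇒≤ {p} {q} 0≤q p²≤q² with p ≤? q
... | yes p≤q = p≤q
... | no p≰q = contradiction (<-≤-trans q²<p² p²≤q²) (<-irrefl refl)
  where
  q<p = ≰⇒> p≰q
  q²<p² = ≤-<-trans (*-monoˡ-≤-nonNeg q {{nonNegative 0≤q}} (<⇒≤ q<p))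
                    (*-monoˡ-<-pos p {{positive (≤-<-trans 0≤q q<p)}} q<p)

≤-square : ∀ {p} → 1ℚ ≤ p → p ≤ p * p
≤-square {p} 1≤p = ≤-trans (≤-reflexive (sym (*-identityʳ p)))
  (*-monoˡ-≤-nonNeg p {{nonNegative (≤-trans (nonNegative⁻¹ 1ℚ) 1≤p)}} 1≤p)

Σ-cong : ∀ n {f g : Fin n → ℚ} → (∀ i → f i ≡ g i) → Σ n f ≡ Σ n g
Σ-cong zero    f≡g = refl
Σ-cong (suc n) f≡g = cong₂ _+_ (f≡g zero) (Σ-cong n (f≡g ∘ suc))

Σ-nonNeg : ∀ n {f : Fin n → ℚ} → (∀ i → 0ℚ ≤ f i) → 0ℚ ≤ Σ n f
Σ-nonNeg zero    0≤f = ≤-refl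
Σ-nonNeg (suc n) 0≤f = +-mono-≤ (0≤f zero) (Σ-nonNeg n (0≤f ∘ suc))

term≤Σ : ∀ n {f : Fin n → ℚ} → (∀ i → 0ℚ ≤ f i) → ∀ i → f i ≤ Σ n f
term≤Σ (suc n) {f} 0≤f zero =
  subst (_≤ Σ (suc n) f) (+-identityʳ (f zero)) (+-monoʳ-≤ (f zero) (Σ-nonNeg n (0≤f ∘ suc)))
term≤Σ (suc n) {f} 0≤f (suc i) =
  subst (_≤ Σ (suc n) f) (+-identityˡ (f (suc i))) (+-mono-≤ (0≤f zero) (term≤Σ n (0≤f ∘ suc) i))

fromℕ : ℕ → ℚ
fromℕ zero    = 0ℚ
fromℕ (suc n) = 1ℚ + fromℕ n

fromℕ-nonNeg : ∀ n → 0ℚ ≤ fromℕ n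
fromℕ-nonNeg zero    = ≤-refl
fromℕ-nonNeg (suc n) = +-mono-≤ (nonNegative⁻¹ 1ℚ) (fromℕ-nonNeg n)

Σ≤fromℕ* : ∀ n {f : Fin n → ℚ} {b} → (∀ i → f i ≤ b) → Σ n f ≤ fromℕ n * b
Σ≤fromℕ* zero    {b = b} f≤b = ≤-reflexive (sym (*-zeroˡ b))
Σ≤fromℕ* (suc n) {b = b} f≤b = ≤-trans (+-mono-≤ (f≤b zero) (Σ≤fromℕ* n (f≤b ∘ suc)))
  (≤-reflexive (solve 2 (λ b m → b :+ m :* b := (con 1ℚ :+ m) :* b) refl b (fromℕ n)))

-- With no square roots at hand, the cross term u S of (u + S)² is bounded
-- through its square: (u S)² ≤ M · m² M = (m M)².
Σ-square≤ : ∀ n {f : Fin n → ℚ} {M} → 0ℚ ≤ M → (∀ i → f i * f i ≤ M) →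
            Σ n f * Σ n f ≤ (fromℕ n * fromℕ n) * M
Σ-square≤ zero    {M = M} _ _ = ≤-reflexive (sym (*-zeroˡ M))
Σ-square≤ (suc n) {f} {M} 0≤M f²≤M = begin
  (u + S) * (u + S)
    ≡⟨ solve 2 (λ u S → (u :+ S) :* (u :+ S) := u :* u :+ (u :* S :+ u :* S) :+ S :* S) refl u S ⟩
  u * u + (u * S + u * S) + S * S
    ≤⟨ +-mono-≤ (+-mono-≤ (f²≤M zero) (+-mono-≤ uS≤mM uS≤mM)) S²≤m²M ⟩
  M + (m * M + m * M) + (m * m) * M
    ≡⟨ solve 2 (λ m M → M :+ (m :* M :+ m :* M) :+ (m :* m) :* M
                        := ((con 1ℚ :+ m) :* (con 1ℚ :+ m)) :* M) refl m M ⟩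
  ((1ℚ + m) * (1ℚ + m)) * M
    ∎
  where
  open ≤-Reasoning
  u = f zero
  S = Σ n (f ∘ suc)
  m = fromℕ n
  S²≤m²M : S * S ≤ (m * m) * M
  S²≤m²M = Σ-square≤ n 0≤M (f²≤M ∘ suc)
  uS≤mM : u * S ≤ m * M
  uS≤mM = square-≤⇒≤ (nonNeg*nonNeg (fromℕ-nonNeg n) 0≤M) (begin
    (u * S) * (u * S) ≡⟨ solve 2 (λ u S → (u :* S) :* (u :* S) := (u :* u) :* (S :* S)) refl u S ⟩
    (u * u) * (S * S) ≤⟨ *-mono-≤-nonNeg (square-nonNeg u) (square-nonNeg S) (f²≤M zero) S²≤m²M ⟩
    M * ((m * m) * M) ≡⟨ solve 2 (λ m M → M :* ((m :* m) :* M) := (m :* M) :* (m :* M)) refl m M ⟩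
    (m * M) * (m * M) ∎)

sqLen-nonNeg : ∀ n (w : Fin n → ℤ) → 0ℚ ≤ sqLen n w
sqLen-nonNeg n w = Σ-nonNeg n (square-nonNeg ∘ ι ∘ w)

coord²≤sqLen : ∀ n (w : Fin n → ℤ) s → ι (w s) * ι (w s) ≤ sqLen n w
coord²≤sqLen n w = term≤Σ n (square-nonNeg ∘ ι ∘ w)

mulVec : ∀ {m n} → Mat m n → (Fin n → ℤ) → Fin m → ℚ
mulVec {n = n} A w r = Σ n (λ s → ι (A r s) * ι (w s))

sqNorm-mulVec≤ : ∀ m n (A : Mat m n) T → maxNormLE m n A T → (w : Fin n → ℤ) →
  sqNorm m (mulVec A w) ≤ (fromℕ m * (fromℕ n * fromℕ n)) * ((T * T) * sqLen n w)
sqNorm-mulVec≤ m n A T ‖A‖≤T w = begin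
  sqNorm m (mulVec A w)                            ≤⟨ Σ≤fromℕ* m (λ r → Σ-square≤ n 0≤T²L (entry²≤ r)) ⟩
  fromℕ m * ((fromℕ n * fromℕ n) * ((T * T) * L))  ≡⟨ sym (*-assoc (fromℕ m) _ _) ⟩
  (fromℕ m * (fromℕ n * fromℕ n)) * ((T * T) * L)  ∎
  where
  open ≤-Reasoning
  L = sqLen n w
  0≤T²L : 0ℚ ≤ (T * T) * L
  0≤T²L = nonNeg*nonNeg (square-nonNeg T) (sqLen-nonNeg n w)
  entry²≤ : ∀ r s → (ι (A r s) * ι (w s)) * (ι (A r s) * ι (w s)) ≤ (T * T) * L
  entry²≤ r s = begin
    (a * b) * (a * b) ≡⟨ solve 2 (λ a b → (a :* b) :* (a :* b) := (a :* a) :* (b :* b)) refl a b ⟩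
    (a * a) * (b * b) ≤⟨ *-mono-≤-nonNeg (square-nonNeg a) (square-nonNeg b) (‖A‖≤T r s) (coord²≤sqLen n w s) ⟩
    (T * T) * L       ∎
    where
    a = ι (A r s)
    b = ι (w s)

restrictionMatrix-entry≤image : ∀ {k n c A v G} → ReducedProp k n c v → IsRestrictionMatrix k n A v G →
  ∀ i j → (ι (G i j) * ι (G i j)) * sqLen n (v i) ≤ (c * c) * sqNorm n (mulVec A (v j))
restrictionMatrix-entry≤image {k} {n} {c} {A} {v} {G} reduced Av≡Gv i j = begin
  (ι (G i j) * ι (G i j)) * sqLen n (v i)
    ≤⟨ reduced (λ h → ι (G h j)) i ⟩
  (c * c) * sqNorm n (λ r → Σ k (λ h → ι (G h j) * ι (v h r)))
    ≡⟨ cong ((c * c) *_) (Σ-cong n (λ r → cong₂ _*_ (sym (Av≡Gv j r)) (sym (Av≡Gv j r)))) ⟩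
  (c * c) * sqNorm n (mulVec A (v j))
    ∎
  where open ≤-Reasoning

restrictionMatrix-entry≤ : ∀ {k n c T A v G} → ReducedProp k n c v → maxNormLE n n A T →
  IsRestrictionMatrix k n A v G → ∀ i j →
  (ι (G i j) * ι (G i j)) * sqLen n (v i)
    ≤ (((c * c) * (fromℕ n * (fromℕ n * fromℕ n))) * (T * T)) * sqLen n (v j)
restrictionMatrix-entry≤ {k} {n} {c} {T} {A} {v} {G} reduced ‖A‖≤T Av≡Gv i j = begin
  (ι (G i j) * ι (G i j)) * sqLen n (v i)
    ≤⟨ restrictionMatrix-entry≤image {c = c} {A} {v} {G} reduced Av≡Gv i j ⟩
  (c * c) * sqNorm n (mulVec A (v j))
    ≤⟨ *-monoˡ-≤-nonNeg (c * c) {{nonNegative (square-nonNeg c)}} (sqNorm-mulVec≤ n n A T ‖A‖≤T (v j)) ⟩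
  (c * c) * (n³ * ((T * T) * L))
    ≡⟨ solve 4 (λ c² n³ T² L → c² :* (n³ :* (T² :* L)) := ((c² :* n³) :* T²) :* L) refl (c * c) n³ (T * T) L ⟩
  (((c * c) * n³) * (T * T)) * L
    ∎
  where
  open ≤-Reasoning
  n³ = fromℕ n * (fromℕ n * fromℕ n)
  L = sqLen n (v j)

term≤Σ-upTo : ∀ n (f : ℕ → ℚ) → (∀ k → 0ℚ ≤ f k) → ∀ {k} → k N.≤ n → f k ≤ Σ (suc n) (f ∘ toℕ)
term≤Σ-upTo n f 0≤f k≤n = subst (_≤ Σ (suc n) (f ∘ toℕ)) (cong f (toℕ-fromℕ< (N.s≤s k≤n)))
  (term≤Σ (suc n) (0≤f ∘ toℕ) (fromℕ< (N.s≤s k≤n)))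

entryBoundFactor : (ℕ → ℚ) → ℕ → ℕ → ℚ
entryBoundFactor c n k = (c k * c k) * (fromℕ n * (fromℕ n * fromℕ n))

entryBoundConstant : (ℕ → ℚ) → ℕ → ℚ
entryBoundConstant c n = 1ℚ + Σ (suc n) (entryBoundFactor c n ∘ toℕ)

entryBoundFactor≤constant² : ∀ c n {k} → k N.≤ n →
  entryBoundFactor c n k ≤ entryBoundConstant c n * entryBoundConstant c n
entryBoundFactor≤constant² c n k≤n =
  ≤-trans (≤-trans (term≤Σ-upTo n (entryBoundFactor c n) 0≤factor k≤n) S≤C) (≤-square 1≤C)
  where
  m = fromℕ n
  S = Σ (suc n) (entryBoundFactor c n ∘ toℕ)
  C = entryBoundConstant c n
  0≤factor : ∀ k → 0ℚ ≤ entryBoundFactor c n k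
  0≤factor k = nonNeg*nonNeg (square-nonNeg (c k)) (nonNeg*nonNeg (fromℕ-nonNeg n) (square-nonNeg m))
  0≤S : 0ℚ ≤ S
  0≤S = Σ-nonNeg (suc n) (0≤factor ∘ toℕ)
  1≤C : 1ℚ ≤ C
  1≤C = subst (_≤ C) (+-identityʳ 1ℚ) (+-monoʳ-≤ 1ℚ 0≤S)
  S≤C : S ≤ C
  S≤C = subst (_≤ C) (+-identityˡ S) (+-monoˡ-≤ S (nonNegative⁻¹ 1ℚ))

mainTheorem5 : (c : ℕ → ℚ) (n : ℕ) → 2 N.≤ n →
    Σ[ C ∈ ℚ ]
      ((k : ℕ) → 1 N.≤ k → k N.≤ n →
       (T : ℚ) → 1ℚ ≤ℚ T →
       (A : Mat n n) → maxNormLE n n A T →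
       (v : Fin k → Fin n → ℤ) → ReducedBasis c k n v →
       (G : Mat k k) → IsRestrictionMatrix k n A v G →
       ∀ i j → (ι (G i j) * ι (G i j)) * sqLen n (v i)
                 ≤ℚ ((C * C) * (T * T)) * sqLen n (v j))
mainTheorem5 c n _ = entryBoundConstant c n ,
  λ k _ k≤n T _ A ‖A‖≤T v (_ , _ , reduced) G Av≡Gv i j →
    ≤-trans (restrictionMatrix-entry≤ {c = c k} {T} {A} {v} {G} reduced ‖A‖≤T Av≡Gv i j)
      (*-monoʳ-≤-nonNeg (sqLen n (v j)) {{nonNegative (sqLen-nonNeg n (v j))}}
        (*-monoʳ-≤-nonNeg (T * T) {{nonNegative (square-nonNeg T)}}
          (entryBoundFactor≤constant² c n k≤n)))
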